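{- Let $D$ and $E$ be $\mathcal V$-dcpos with small compact bases $\beta_D:B_D\to D$ and $\beta_E:B_E\to E$, and suppose $E$ has suprema of all (not necessarily directed) families indexed by types in $\mathcal V$. Let $\sigma:B_D\times B_E\to E^D$ send $(b,c)$ to the single step function $\lceil\beta_D(b),\beta_E(c)\rceil$, and let $\beta:\mathrm{List}(B_D\times B_E)\to E^D$ be the directification of $\sigma$. Then $\beta$ is a small compact basis for the exponential $E^D$.
   Context: Setting: intensional Martin-Löf type theory with universes, function extensionality, propositional extensionality and propositional truncations. A $\mathcal V$-dcpo is a poset (proposition-valued reflexive transitive antisymmetric order) in which every directed family (inhabited index type, and any two indices have an upper bound index, with "exists" truncated) indexed by a type in $\mathcal V$ has a supremum; Scott continuous maps preserve such suprema. For $x,y:D$, $x$ is way below $y$ ($x\ll y$) if for every directed $\alpha:I\to D$ with $I:\mathcal V$ and $y\sqsubseteq\bigsqcup\alpha$ there exists $i$ with $x\sqsubseteq\alpha_i$; $x$ is compact if $x\ll x$. A small compact basis for $D$ is a map $\beta:B\to D$ with $B:\mathcal V$ such that every $\beta(b)$ is compact, every proposition $\beta(b)\sqsubseteq x$ is $\mathcal V$-small (equivalent to a type in $\mathcal V$), and for every $x:D$ the family $\Sigma_{b:B}(\beta(b)\sqsubseteq x)\to D$, $(b,\_)\mapsto\beta(b)$, is directed with supremum $x$. The exponential $E^D$ is the $\mathcal V$-dcpo of Scott continuous maps $D\to E$ with pointwise order and pointwise suprema; here it has suprema of all $\mathcal V$-indexed families, computed pointwise. For $d:D$ such that each $d\sqsubseteq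 x$ is $\mathcal V$-small and $e:E$, the single step function $\lceil d,e\rceil:D\to E$ sends $x$ to the supremum of the family indexed by the proposition $d\sqsubseteq x$ that is constantly $e$; it is Scott continuous when $d$ is compact. In a poset $P$ with suprema of all $\mathcal V$-indexed families, the directification of $\alpha:I\to P$ is $\bar\alpha:\mathrm{List}(I)\to P$ defined by $\bar\alpha([])=\bot$ and $\bar\alpha(i::l)=\alpha_i\vee\bar\alpha(l)$ (binary join). -}

module Defs where

-- The ambient axioms (function extensionality, propositional extensionality,
-- propositional truncations) are not available in --safe Agda, so they are
-- taken as explicit hypotheses (see Domains module parameters and the statement).

open import Level using (Level; _⊔_; Lift; lift; lower; Setω) renaming (suc to lsuc)
open import Data.Product using (Σ; _×_; _,_; proj₁; proj₂)
open import Data.Bool using (Bool; true; false)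
open import Data.Empty.Polymorphic using (⊥; ⊥-elim)
open import Data.List using (List; []; _∷_)
open import Function.Bundles using (_↔_; Inverse)
open import Relation.Binary.PropositionalEquality using (_≡_; refl; cong; cong₂)
open import Axiom.Extensionality.Propositional using (Extensionality)

isProp : ∀ {ℓ} → Set ℓ → Set ℓ
isProp A = (x y : A) → x ≡ y

FunExt : Setω
FunExt = ∀ {a b} → Extensionality a b

PropExt : Setω
PropExt = ∀ {ℓ} {P Q : Set ℓ} → isProp P → isProp Q → (P → Q) → (Q → P) → P ≡ Q

record PropTrunc : Setω where
  field
    ∥_∥ : ∀ {ℓ} → Set ℓ → Set ℓ
    ∣_∣ : ∀ {ℓ} {A : Set ℓ} → A → ∥ A ∥
    ∥∥-is-prop : ∀ {ℓ} {A : Set ℓ} → isProp ∥ A ∥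
    ∥∥-rec : ∀ {ℓ ℓ'} {A : Set ℓ} {P : Set ℓ'} → isProp P → (A → P) → ∥ A ∥ → P

is-small : ∀ {ℓ} (v : Level) → Set ℓ → Set (lsuc v ⊔ ℓ)
is-small v X = Σ (Set v) (λ S → S ↔ X)

module Domains (pt : PropTrunc) (fe : FunExt) where
  open PropTrunc pt

  Π-is-prop : ∀ {a b} {A : Set a} {B : A → Set b} → ((x : A) → isProp (B x)) → isProp ((x : A) → B x)
  Π-is-prop h f g = fe (λ x → h x (f x) (g x))

  ×-is-prop : ∀ {a b} {A : Set a} {B : Set b} → isProp A → isProp B → isProp (A × B)
  ×-is-prop pa pb (a , b) (a' , b') = cong₂ _,_ (pa a a') (pb b b')

  Σ-prop-≡ : ∀ {a b} {A : Set a} {B : A → Set b} → ((x : A) → isProp (B x)) → {p q : Σ A B} → proj₁ p ≡ proj₁ q → p ≡ q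
  Σ-prop-≡ h {a , b} {.a , c} refl = cong (a ,_) (h a b c)

  module _ {u t : Level} {X : Set u} (_≤_ : X → X → Set t) where
    is-upperbound : ∀ {ℓ} {I : Set ℓ} → X → (I → X) → Set (ℓ ⊔ t)
    is-upperbound s α = ∀ i → α i ≤ s

    is-sup : ∀ {ℓ} {I : Set ℓ} → X → (I → X) → Set (ℓ ⊔ u ⊔ t)
    is-sup s α = is-upperbound s α × ((w : X) → is-upperbound w α → s ≤ w)

    is-directed : ∀ {ℓ} {I : Set ℓ} → (I → X) → Set (ℓ ⊔ t)
    is-directed {I = I} α = ∥ I ∥ × ((i j : I) → ∥ Σ I (λ k → (α i ≤ α k) × (α j ≤ α k)) ∥)

  -- V-dcpos (v = level of the universe V of index types)
  record DCPO (v u t : Level) : Set (lsuc (v ⊔ u ⊔ t)) where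
    field
      Carrier : Set u
      _⊑_ : Carrier → Carrier → Set t
      ⊑-prop : (x y : Carrier) → isProp (x ⊑ y)
      ⊑-refl : (x : Carrier) → x ⊑ x
      ⊑-trans : (x y z : Carrier) → x ⊑ y → y ⊑ z → x ⊑ z
      ⊑-antisym : (x y : Carrier) → x ⊑ y → y ⊑ x → x ≡ y
      ∐ : {I : Set v} (α : I → Carrier) → is-directed _⊑_ α → Carrier
      ∐-is-sup : {I : Set v} (α : I → Carrier) (δ : is-directed _⊑_ α) → is-sup _⊑_ (∐ α δ) α

  ⟨_⟩ : ∀ {v u t} → DCPO v u t → Set u
  ⟨ D ⟩ = DCPO.Carrier D

  module _ {v u t : Level} (D : DCPO v u t) where
    open DCPO D

    way-below : Carrier → Carrier → Set (lsuc v ⊔ u ⊔ t)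
    way-below x y = (I : Set v) (α : I → Carrier) (δ : is-directed _⊑_ α) → y ⊑ ∐ α δ → ∥ Σ I (λ i → x ⊑ α i) ∥

    is-compact : Carrier → Set (lsuc v ⊔ u ⊔ t)
    is-compact x = way-below x x

    ↓ι : {B : Set v} (β : B → Carrier) (x : Carrier) → Σ B (λ b → β b ⊑ x) → Carrier
    ↓ι β x p = β (proj₁ p)

  record is-small-compact-basis {v u t : Level} (D : DCPO v u t) {B : Set v} (β : B → ⟨ D ⟩) : Set (lsuc v ⊔ u ⊔ t) where
    open DCPO D
    field
      basis-is-compact : (b : B) → is-compact D (β b)
      ⊑ᴮ-is-small : (x : Carrier) (b : B) → is-small v (β b ⊑ x)
      ↓ᴮ-is-directed : (x : Carrier) → is-directed _⊑_ (↓ι D β x)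
      ↓ᴮ-is-sup : (x : Carrier) → is-sup _⊑_ x (↓ι D β x)

  has-all-sups : ∀ {v u t} → DCPO v u t → Set (lsuc v ⊔ u ⊔ t)
  has-all-sups {v} E = (I : Set v) (α : I → ⟨ E ⟩) → Σ ⟨ E ⟩ (λ s → is-sup (DCPO._⊑_ E) s α)

  module _ {v u t u' t' : Level} (D : DCPO v u t) (E : DCPO v u' t') where
    private
      module D = DCPO D
      module E = DCPO E

    is-continuous : (⟨ D ⟩ → ⟨ E ⟩) → Set (lsuc v ⊔ u ⊔ t ⊔ u' ⊔ t')
    is-continuous f = (I : Set v) (α : I → ⟨ D ⟩) (δ : is-directed D._⊑_ α) → is-sup E._⊑_ (f (D.∐ α δ)) (λ i → f (α i))

    is-sup-is-prop : ∀ {ℓ} {I : Set ℓ} (s : ⟨ E ⟩) (α : I → ⟨ E ⟩) → isProp (is-sup E._⊑_ s α)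
    is-sup-is-prop s α = ×-is-prop (Π-is-prop (λ i → E.⊑-prop (α i) s))
                                    (Π-is-prop (λ w → Π-is-prop (λ _ → E.⊑-prop s w)))

    continuity-is-prop : (f : ⟨ D ⟩ → ⟨ E ⟩) → isProp (is-continuous f)
    continuity-is-prop f = Π-is-prop (λ I → Π-is-prop (λ α → Π-is-prop (λ δ → is-sup-is-prop _ _)))

    sup-of-continuous : ∀ {ℓ} {I : Set ℓ} (α : I → ⟨ D ⟩ → ⟨ E ⟩) → ((i : I) → is-continuous (α i))
                      → (s : ⟨ D ⟩ → ⟨ E ⟩) → ((x : ⟨ D ⟩) → is-sup E._⊑_ (s x) (λ i → α i x)) → is-continuous s
    sup-of-continuous α c s hs J γ δ = ub , lb
      where
        ∐γ = D.∐ γ δ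
        ub : (j : J) → s (γ j) E.⊑ s ∐γ
        ub j = proj₂ (hs (γ j)) (s ∐γ) (λ i → E.⊑-trans _ _ _ (proj₁ (c i J γ δ) j) (proj₁ (hs ∐γ) i))
        lb : (w : ⟨ E ⟩) → ((j : J) → s (γ j) E.⊑ w) → s ∐γ E.⊑ w
        lb w hw = proj₂ (hs ∐γ) w (λ i → proj₂ (c i J γ δ) w (λ j → E.⊑-trans _ _ _ (proj₁ (hs (γ j)) i) (hw j)))

    exponential : DCPO v (lsuc v ⊔ u ⊔ t ⊔ u' ⊔ t') (u ⊔ t')
    exponential = record
      { Carrier = Σ (⟨ D ⟩ → ⟨ E ⟩) is-continuous
      ; _⊑_ = λ f g → (x : ⟨ D ⟩) → proj₁ f x E.⊑ proj₁ g x
      ; ⊑-prop = λ f g → Π-is-prop (λ x → E.⊑-prop _ _)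
      ; ⊑-refl = λ f x → E.⊑-refl _
      ; ⊑-trans = λ f g h p q x → E.⊑-trans _ _ _ (p x) (q x)
      ; ⊑-antisym = λ f g p q → Σ-prop-≡ continuity-is-prop (fe (λ x → E.⊑-antisym _ _ (p x) (q x)))
      ; ∐ = λ α δ → (λ x → E.∐ (λ i → proj₁ (α i) x) (pw α δ x))
                    , sup-of-continuous (λ i → proj₁ (α i)) (λ i → proj₂ (α i)) _ (λ x → E.∐-is-sup _ (pw α δ x))
      ; ∐-is-sup = λ α δ → (λ i x → proj₁ (E.∐-is-sup _ (pw α δ x)) i)
                         , (λ w hw x → proj₂ (E.∐-is-sup _ (pw α δ x)) (proj₁ w x) (λ i → hw i x))
      }
      where
        pw : {I : Set v} (α : I → Σ (⟨ D ⟩ → ⟨ E ⟩) is-continuous)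
           → is-directed (λ f g → (x : ⟨ D ⟩) → proj₁ f x E.⊑ proj₁ g x) α
           → (x : ⟨ D ⟩) → is-directed E._⊑_ (λ i → proj₁ (α i) x)
        pw α δ x = proj₁ δ , λ i j → PropTrunc.∥∥-rec pt (PropTrunc.∥∥-is-prop pt)
                                        (λ { (k , p , q) → ∣ k , p x , q x ∣ }) (proj₂ δ i j)

  _^_ : ∀ {v u t u' t'} → DCPO v u' t' → DCPO v u t → DCPO v (lsuc v ⊔ u ⊔ t ⊔ u' ⊔ t') (u ⊔ t')
  E ^ D = exponential D E

  module _ {v u t u' t' : Level} (D : DCPO v u t) (E : DCPO v u' t') (sups : has-all-sups E) where
    private
      module D = DCPO D
      module E = DCPO E

    ⋁^ : {I : Set v} → (I → ⟨ E ^ D ⟩) → ⟨ E ^ D ⟩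
    ⋁^ {I} α = (λ x → proj₁ (sups I (λ i → proj₁ (α i) x)))
             , sup-of-continuous D E (λ i → proj₁ (α i)) (λ i → proj₂ (α i)) _ (λ x → proj₂ (sups I _))

    ⊥^ : ⟨ E ^ D ⟩
    ⊥^ = ⋁^ {I = ⊥} ⊥-elim

    _∨^_ : ⟨ E ^ D ⟩ → ⟨ E ^ D ⟩ → ⟨ E ^ D ⟩
    f ∨^ g = ⋁^ {I = Lift v Bool} (λ { (lift true) → f ; (lift false) → g })

    directify : {I : Set v} → (I → ⟨ E ^ D ⟩) → List I → ⟨ E ^ D ⟩
    directify σ [] = ⊥^
    directify σ (i ∷ l) = σ i ∨^ directify σ l

    step-function : (d : ⟨ D ⟩) → is-compact D d → ((x : ⟨ D ⟩) → is-small v (d D.⊑ x)) → ⟨ E ⟩ → ⟨ E ^ D ⟩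
    step-function d c sm e = f , cont
      where
        S : ⟨ D ⟩ → Set v
        S x = proj₁ (sm x)
        f : ⟨ D ⟩ → ⟨ E ⟩
        f x = proj₁ (sups (S x) (λ _ → e))
        hs : (x : ⟨ D ⟩) → is-sup E._⊑_ (f x) (λ (_ : S x) → e)
        hs x = proj₂ (sups (S x) (λ _ → e))
        to : (x : ⟨ D ⟩) → S x → d D.⊑ x
        to x = Inverse.to (proj₂ (sm x))
        from : (x : ⟨ D ⟩) → d D.⊑ x → S x
        from x = Inverse.from (proj₂ (sm x))
        cont : is-continuous D E f
        cont J γ δ = ub , lb
          where
            ∐γ = D.∐ γ δ
            ub : (j : J) → f (γ j) E.⊑ f ∐γ
            ub j = proj₂ (hs (γ j)) (f ∐γ)
                     (λ p → proj₁ (hs ∐γ) (from ∐γ (D.⊑-trans _ _ _ (to (γ j) p) (proj₁ (D.∐-is-sup γ δ) j))))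
            lb : (w : ⟨ E ⟩) → ((j : J) → f (γ j) E.⊑ w) → f ∐γ E.⊑ w
            lb w hw = proj₂ (hs ∐γ) w
                        (λ p → ∥∥-rec (E.⊑-prop e w)
                                 (λ { (j , q) → E.⊑-trans _ _ _ (proj₁ (hs (γ j)) (from (γ j) q)) (hw j) })
                                 (c J γ δ (to ∐γ p)))

    step-functions : {BD : Set v} (βD : BD → ⟨ D ⟩) → is-small-compact-basis D βD
                   → {BE : Set v} (βE : BE → ⟨ E ⟩) → BD × BE → ⟨ E ^ D ⟩
    step-functions βD bD βE (b , c) =
      step-function (βD b) (is-small-compact-basis.basis-is-compact bD b)
                    (λ x → is-small-compact-basis.⊑ᴮ-is-small bD x b) (βE c)

    directified-step-functions : {BD : Set v} (βD : BD → ⟨ D ⟩) → is-small-compact-basis D βD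
                               → {BE : Set v} (βE : BE → ⟨ E ⟩) → List (BD × BE) → ⟨ E ^ D ⟩
    directified-step-functions βD bD βE = directify (step-functions βD bD βE)

module Submission where

-- A continuous f : D → E is the join of the step functions ⌈βD b , βE c⌉ below it:
-- a compact βE c ⊑ f x = ∐ f (βD b) over basis elements βD b ⊑ x lies below some
-- f (βD b), and then ⌈βD b , βE c⌉ ⊑ f. Finite joins of these step functions are
-- compact because binary joins of compacts are compact, and "a finite join is below
-- f" is a finite conjunction of small propositions e ⊑ f d, hence small.

open import Level using (Level; Lift; lift)
open import Defs
open import Data.Product using (Σ; _×_; _,_; proj₁; proj₂)
open import Data.Bool using (Bool; true; false)
open import Data.List using (List; []; _∷_; [_]; _++_)
open import Data.List.Relation.Unary.All as All using (All; []; _∷_)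
open import Data.List.Relation.Unary.All.Properties using (++⁺; ++⁻ˡ; ++⁻ʳ; singleton⁻)
open import Function.Bundles using (_↔_; Inverse; mk↔ₛ′)
open import Relation.Binary.PropositionalEquality using (_≡_; refl; subst; sym; trans; cong; cong₂)

isProp-↔ : ∀ {a b} {S : Set a} {P : Set b} → S ↔ P → isProp P → isProp S
isProp-↔ e isP s s' = trans (sym (Inverse.strictlyInverseʳ e s))
  (trans (cong (Inverse.from e) (isP _ _)) (Inverse.strictlyInverseʳ e s'))

All-isProp : ∀ {a p} {A : Set a} {P : A → Set p} → (∀ x → isProp (P x)) → (xs : List A) → isProp (All P xs)
All-isProp isP []       []       []       = refl
All-isProp isP (x ∷ xs) (p ∷ ps) (q ∷ qs) = cong₂ _∷_ (isP x p q) (All-isProp isP xs ps qs)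

module _ (pt : PropTrunc) (fe : FunExt) where
  open Domains pt fe
  open PropTrunc pt

  module _ {v u t u' t' : Level} (D : DCPO v u t) (E : DCPO v u' t') where
    private
      module D = DCPO D
      module E = DCPO E

    continuous-is-monotone : (f : ⟨ D ⟩ → ⟨ E ⟩) → is-continuous D E f
                           → (x y : ⟨ D ⟩) → x D.⊑ y → f x E.⊑ f y
    continuous-is-monotone f c x y x⊑y =
      subst (λ z → f x E.⊑ f z) ∐γ≡y (proj₁ (c (Lift v Bool) γ δ) (lift true))
      where
        γ : Lift v Bool → ⟨ D ⟩
        γ (lift true)  = x
        γ (lift false) = y
        γ⊑y : (i : Lift v Bool) → γ i D.⊑ y
        γ⊑y (lift true)  = x⊑y
        γ⊑y (lift false) = D.⊑-refl y
        δ : is-directed D._⊑_ γ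
        δ = ∣ lift true ∣ , λ i j → ∣ lift false , γ⊑y i , γ⊑y j ∣
        ∐γ≡y : D.∐ γ δ ≡ y
        ∐γ≡y = D.⊑-antisym _ _ (proj₂ (D.∐-is-sup γ δ) y γ⊑y) (proj₁ (D.∐-is-sup γ δ) (lift false))

    monotone-image-is-directed : (f : ⟨ D ⟩ → ⟨ E ⟩) → ((x y : ⟨ D ⟩) → x D.⊑ y → f x E.⊑ f y)
                               → ∀ {ℓ} {I : Set ℓ} (α : I → ⟨ D ⟩) → is-directed D._⊑_ α
                               → is-directed E._⊑_ (λ i → f (α i))
    monotone-image-is-directed f mono α (inhabited , semidirected) = inhabited ,
      λ i j → ∥∥-rec ∥∥-is-prop (λ { (k , i⊑k , j⊑k) → ∣ k , mono _ _ i⊑k , mono _ _ j⊑k ∣ })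
                               (semidirected i j)

  -- The family ↓ι β x is indexed by a type that need not live in V; reindex it over
  -- the small copies of the propositions β b ⊑ x so that it has a supremum in D.
  module SmallBasis {v u t : Level} (D : DCPO v u t) {B : Set v} {β : B → ⟨ D ⟩}
                    (bβ : is-small-compact-basis D β) (x : ⟨ D ⟩) where
    private
      module D = DCPO D
      open is-small-compact-basis bβ

    ⊑ᴮ-small : B → Set v
    ⊑ᴮ-small b = proj₁ (⊑ᴮ-is-small x b)

    ⊑ᴮ-small→⊑ : (b : B) → ⊑ᴮ-small b → β b D.⊑ x
    ⊑ᴮ-small→⊑ b = Inverse.to (proj₂ (⊑ᴮ-is-small x b))

    ⊑→⊑ᴮ-small : (b : B) → β b D.⊑ x → ⊑ᴮ-small b
    ⊑→⊑ᴮ-small b = Inverse.from (proj₂ (⊑ᴮ-is-small x b))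

    ↓ᴮˢ : Set v
    ↓ᴮˢ = Σ B ⊑ᴮ-small

    ↓ιˢ : ↓ᴮˢ → ⟨ D ⟩
    ↓ιˢ (b , _) = β b

    ↓ιˢ-is-directed : is-directed D._⊑_ ↓ιˢ
    ↓ιˢ-is-directed =
        ∥∥-rec ∥∥-is-prop (λ { (b , b⊑x) → ∣ b , ⊑→⊑ᴮ-small b b⊑x ∣ }) (proj₁ (↓ᴮ-is-directed x))
      , λ { (b₁ , s₁) (b₂ , s₂) →
              ∥∥-rec ∥∥-is-prop (λ { ((b , b⊑x) , ⊑₁ , ⊑₂) → ∣ (b , ⊑→⊑ᴮ-small b b⊑x) , ⊑₁ , ⊑₂ ∣ })
                     (proj₂ (↓ᴮ-is-directed x) (b₁ , ⊑ᴮ-small→⊑ b₁ s₁) (b₂ , ⊑ᴮ-small→⊑ b₂ s₂)) }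

    ⊑-∐-↓ιˢ : x D.⊑ D.∐ ↓ιˢ ↓ιˢ-is-directed
    ⊑-∐-↓ιˢ = proj₂ (↓ᴮ-is-sup x) _
      (λ { (b , b⊑x) → proj₁ (D.∐-is-sup ↓ιˢ ↓ιˢ-is-directed) (b , ⊑→⊑ᴮ-small b b⊑x) })

  compact-⊑-continuous-image : ∀ {v u t u' t'} (D : DCPO v u t) (E : DCPO v u' t')
    {B : Set v} {β : B → ⟨ D ⟩} → is-small-compact-basis D β
    → (f : ⟨ D ⟩ → ⟨ E ⟩) → is-continuous D E f
    → (e : ⟨ E ⟩) → is-compact E e → (x : ⟨ D ⟩) → DCPO._⊑_ E e (f x)
    → ∥ Σ B (λ b → DCPO._⊑_ D (β b) x × DCPO._⊑_ E e (f (β b))) ∥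
  compact-⊑-continuous-image D E bβ f cf e ce x e⊑fx =
    ∥∥-rec ∥∥-is-prop (λ { ((b , s) , e⊑fβb) → ∣ b , ⊑ᴮ-small→⊑ b s , e⊑fβb ∣ })
           (ce ↓ᴮˢ (λ j → f (↓ιˢ j)) fδ e⊑∐)
    where
      module E = DCPO E
      open SmallBasis D bβ x
      mono = continuous-is-monotone D E f cf
      δ = ↓ιˢ-is-directed
      fδ = monotone-image-is-directed D E f mono ↓ιˢ δ
      e⊑∐ : e E.⊑ E.∐ (λ j → f (↓ιˢ j)) fδ
      e⊑∐ = E.⊑-trans _ _ _ (E.⊑-trans _ _ _ e⊑fx (mono _ _ ⊑-∐-↓ιˢ))
              (proj₂ (cf ↓ᴮˢ ↓ιˢ δ) _ (proj₁ (E.∐-is-sup _ fδ)))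

  module Exponential {v u t u' t' : Level} (D : DCPO v u t) (E : DCPO v u' t') (sups : has-all-sups E) where
    private
      module D = DCPO D
      module E = DCPO E
      module ED = DCPO (E ^ D)

    open ED using (_⊑_)

    ⊥^-least : (f : ⟨ E ^ D ⟩) → ⊥^ D E sups ⊑ f
    ⊥^-least f x = proj₂ (proj₂ (sups _ _)) (proj₁ f x) (λ ())

    ∨^-upperˡ : (f g : ⟨ E ^ D ⟩) → f ⊑ _∨^_ D E sups f g
    ∨^-upperˡ f g x = proj₁ (proj₂ (sups _ _)) (lift true)

    ∨^-upperʳ : (f g : ⟨ E ^ D ⟩) → g ⊑ _∨^_ D E sups f g
    ∨^-upperʳ f g x = proj₁ (proj₂ (sups _ _)) (lift false)

    ∨^-least : (f g h : ⟨ E ^ D ⟩) → f ⊑ h → g ⊑ h → _∨^_ D E sups f g ⊑ h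
    ∨^-least f g h f⊑h g⊑h x =
      proj₂ (proj₂ (sups _ _)) (proj₁ h x) λ { (lift true) → f⊑h x ; (lift false) → g⊑h x }

    ⊥^-is-compact : is-compact (E ^ D) (⊥^ D E sups)
    ⊥^-is-compact I α δ _ = ∥∥-rec ∥∥-is-prop (λ i → ∣ i , ⊥^-least (α i) ∣) (proj₁ δ)

    ∨^-is-compact : (f g : ⟨ E ^ D ⟩) → is-compact (E ^ D) f → is-compact (E ^ D) g
                  → is-compact (E ^ D) (_∨^_ D E sups f g)
    ∨^-is-compact f g cf cg I α δ f∨g⊑∐ =
      ∥∥-rec ∥∥-is-prop (λ { (i , f⊑αi) →
        ∥∥-rec ∥∥-is-prop (λ { (j , g⊑αj) →
          ∥∥-rec ∥∥-is-prop (λ { (k , i⊑k , j⊑k) →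
            ∣ k , ∨^-least f g (α k) (ED.⊑-trans f (α i) (α k) f⊑αi i⊑k) (ED.⊑-trans g (α j) (α k) g⊑αj j⊑k) ∣ })
            (proj₂ δ i j) })
          (cg I α δ (ED.⊑-trans g (_∨^_ D E sups f g) (ED.∐ α δ) (∨^-upperʳ f g) f∨g⊑∐)) })
        (cf I α δ (ED.⊑-trans f (_∨^_ D E sups f g) (ED.∐ α δ) (∨^-upperˡ f g) f∨g⊑∐))

    module _ {I : Set v} (σ : I → ⟨ E ^ D ⟩) where
      private
        σ̄ = directify D E sups σ

      All⇒directify-⊑ : (f : ⟨ E ^ D ⟩) (l : List I) → All (λ i → σ i ⊑ f) l → σ̄ l ⊑ f
      All⇒directify-⊑ f []      []               = ⊥^-least f
      All⇒directify-⊑ f (i ∷ l) (σi⊑f ∷ σl⊑f) = ∨^-least (σ i) (σ̄ l) f σi⊑f (All⇒directify-⊑ f l σl⊑f)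

      directify-⊑⇒All : (f : ⟨ E ^ D ⟩) (l : List I) → σ̄ l ⊑ f → All (λ i → σ i ⊑ f) l
      directify-⊑⇒All f []      _   = []
      directify-⊑⇒All f (i ∷ l) σ̄⊑f =
          ED.⊑-trans (σ i) (σ̄ (i ∷ l)) f (∨^-upperˡ (σ i) (σ̄ l)) σ̄⊑f
        ∷ directify-⊑⇒All f l (ED.⊑-trans (σ̄ l) (σ̄ (i ∷ l)) f (∨^-upperʳ (σ i) (σ̄ l)) σ̄⊑f)

      directify-is-compact : ((i : I) → is-compact (E ^ D) (σ i)) → (l : List I) → is-compact (E ^ D) (σ̄ l)
      directify-is-compact cσ []      = ⊥^-is-compact
      directify-is-compact cσ (i ∷ l) = ∨^-is-compact (σ i) (σ̄ l) (cσ i) (directify-is-compact cσ l)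

      directify-⊑-is-small : (f : ⟨ E ^ D ⟩) → ((i : I) → is-small v (σ i ⊑ f))
                           → (l : List I) → is-small v (σ̄ l ⊑ f)
      directify-⊑-is-small f small l =
          All (λ i → proj₁ (small i)) l
        , mk↔ₛ′ (λ s → All⇒directify-⊑ f l (All.map (Inverse.to (proj₂ (small _))) s))
                (λ p → All.map (Inverse.from (proj₂ (small _))) (directify-⊑⇒All f l p))
                (λ _ → ED.⊑-prop (σ̄ l) f _ _)
                (λ _ → All-isProp (λ i → isProp-↔ (proj₂ (small i)) (ED.⊑-prop (σ i) f)) l _ _)

      directify-↓-is-directed : (f : ⟨ E ^ D ⟩) → is-directed _⊑_ (↓ι (E ^ D) σ̄ f)
      directify-↓-is-directed f = ∣ [] , ⊥^-least f ∣ ,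
        λ { (l₁ , l₁⊑f) (l₂ , l₂⊑f) →
              ∣ (l₁ ++ l₂ , All⇒directify-⊑ f (l₁ ++ l₂)
                              (++⁺ (directify-⊑⇒All f l₁ l₁⊑f) (directify-⊑⇒All f l₂ l₂⊑f)))
              , All⇒directify-⊑ (σ̄ (l₁ ++ l₂)) l₁ (++⁻ˡ l₁ (σ̄-below l₁ l₂))
              , All⇒directify-⊑ (σ̄ (l₁ ++ l₂)) l₂ (++⁻ʳ l₁ (σ̄-below l₁ l₂)) ∣ }
        where
          σ̄-below : (l₁ l₂ : List I) → All (λ i → σ i ⊑ σ̄ (l₁ ++ l₂)) (l₁ ++ l₂)
          σ̄-below l₁ l₂ = directify-⊑⇒All (σ̄ (l₁ ++ l₂)) (l₁ ++ l₂) (ED.⊑-refl (σ̄ (l₁ ++ l₂)))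

    module Step (d : ⟨ D ⟩) (cd : is-compact D d) (sm : (x : ⟨ D ⟩) → is-small v (d D.⊑ x)) (e : ⟨ E ⟩) where
      private
        step = step-function D E sups d cd sm e

      ⊑⇒step-function-⊑ : (f : ⟨ E ^ D ⟩) → e E.⊑ proj₁ f d → step ⊑ f
      ⊑⇒step-function-⊑ f e⊑fd x = proj₂ (proj₂ (sups _ _)) (proj₁ f x)
        (λ s → E.⊑-trans _ _ _ e⊑fd
                 (continuous-is-monotone D E (proj₁ f) (proj₂ f) _ _ (Inverse.to (proj₂ (sm x)) s)))

      step-function-⊑⇒⊑ : (f : ⟨ E ^ D ⟩) → step ⊑ f → e E.⊑ proj₁ f d
      step-function-⊑⇒⊑ f step⊑f =
        E.⊑-trans _ _ _ (proj₁ (proj₂ (sups _ _)) (Inverse.from (proj₂ (sm d)) (D.⊑-refl d))) (step⊑f d)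

      step-function-is-compact : is-compact E e → is-compact (E ^ D) step
      step-function-is-compact ce I α δ step⊑∐ =
        ∥∥-rec ∥∥-is-prop (λ { (i , e⊑αid) → ∣ i , ⊑⇒step-function-⊑ (α i) e⊑αid ∣ })
               (ce I (λ i → proj₁ (α i) d) _ (step-function-⊑⇒⊑ (ED.∐ α δ) step⊑∐))

  module StepBasis {v u t u' t' : Level} (D : DCPO v u t) (E : DCPO v u' t')
    {BD : Set v} (βD : BD → ⟨ D ⟩) (bD : is-small-compact-basis D βD)
    {BE : Set v} (βE : BE → ⟨ E ⟩) (bE : is-small-compact-basis E βE)
    (sups : has-all-sups E) where
    private
      module E = DCPO E
      module ED = DCPO (E ^ D)
      module bD = is-small-compact-basis bD
      module bE = is-small-compact-basis bE
      σ = step-functions D E sups βD bD βE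
      σ̄ = directified-step-functions D E sups βD bD βE
    open Exponential D E sups
    open ED using (_⊑_)

    module _ (b : BD) (c : BE) where
      open Step (βD b) (bD.basis-is-compact b) (λ x → bD.⊑ᴮ-is-small x b) (βE c) public

    step-function-⊑-is-small : (f : ⟨ E ^ D ⟩) (bc : BD × BE) → is-small v (σ bc ⊑ f)
    step-function-⊑-is-small f (b , c) =
        proj₁ small
      , mk↔ₛ′ (λ s → ⊑⇒step-function-⊑ b c f (Inverse.to (proj₂ small) s))
              (λ p → Inverse.from (proj₂ small) (step-function-⊑⇒⊑ b c f p))
              (λ _ → ED.⊑-prop (σ (b , c)) f _ _)
              (λ _ → isProp-↔ (proj₂ small) (E.⊑-prop _ _) _ _)
      where
        small = bE.⊑ᴮ-is-small (proj₁ f (βD b)) c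

    ⊑-from-step-functions : (f w : ⟨ E ^ D ⟩) → ((bc : BD × BE) → σ bc ⊑ f → σ bc ⊑ w) → f ⊑ w
    ⊑-from-step-functions f w σ⊑w x = proj₂ (bE.↓ᴮ-is-sup (proj₁ f x)) (proj₁ w x)
      λ { (c , c⊑fx) →
        ∥∥-rec (E.⊑-prop _ _)
          (λ { (b , b⊑x , c⊑fb) →
            E.⊑-trans _ _ _ (step-function-⊑⇒⊑ b c w (σ⊑w (b , c) (⊑⇒step-function-⊑ b c f c⊑fb)))
                            (continuous-is-monotone D E (proj₁ w) (proj₂ w) _ _ b⊑x) })
          (compact-⊑-continuous-image D E bD (proj₁ f) (proj₂ f) (βE c) (bE.basis-is-compact c) x c⊑fx) }

    directified-step-functions-↓-is-sup : (f : ⟨ E ^ D ⟩) → is-sup _⊑_ f (↓ι (E ^ D) σ̄ f)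
    directified-step-functions-↓-is-sup f = (λ { (_ , l⊑f) → l⊑f }) ,
      λ w ↓⊑w → ⊑-from-step-functions f w λ bc σbc⊑f →
        singleton⁻ (directify-⊑⇒All σ w [ bc ]
          (↓⊑w ([ bc ] , All⇒directify-⊑ σ f [ bc ] (σbc⊑f ∷ []))))

mainTheorem13 : (pt : PropTrunc) (fe : FunExt) (pe : PropExt)
    → let open Domains pt fe in
    {v u t u' t' : Level} (D : DCPO v u t) (E : DCPO v u' t')
    {BD : Set v} (βD : BD → ⟨ D ⟩) (bD : is-small-compact-basis D βD)
    {BE : Set v} (βE : BE → ⟨ E ⟩) (bE : is-small-compact-basis E βE)
    (sups : has-all-sups E)
    → is-small-compact-basis (E ^ D) (directified-step-functions D E sups βD bD βE)
mainTheorem13 pt fe pe D E βD bD βE bE sups = record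
  { basis-is-compact = directify-is-compact σ (λ { (b , c) → step-function-is-compact b c (bE.basis-is-compact c) })
  ; ⊑ᴮ-is-small      = λ f → directify-⊑-is-small σ f (step-function-⊑-is-small f)
  ; ↓ᴮ-is-directed   = directify-↓-is-directed σ
  ; ↓ᴮ-is-sup        = directified-step-functions-↓-is-sup
  }
  where
    open Domains pt fe using (step-functions; module is-small-compact-basis)
    open StepBasis pt fe D E βD bD βE bE sups
    open Exponential pt fe D E sups
    module bE = is-small-compact-basis bE
    σ = step-functions D E sups βD bD βE
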